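{- For all integers $n,m\ge 1$, the butterfly graph with parameters $n,m$ is a difference graph.
   Context: A graph $G=(V,E)$ is a difference graph if there is a bijection $f$ from $V$ onto a set $S$ of positive integers such that for all distinct $x,y\in V$: $xy\in E$ if and only if $|f(x)-f(y)|\in S$. The butterfly graph with parameters $n,m$ has vertices $w_0,w_1,u_0,u_1,\dots,u_n,v_0,v_1,\dots,v_m$; its edges are: $w_0$ adjacent to every other vertex; the path edges $w_1u_0$ and $u_{i-1}u_i$ for $1\le i\le n$; and the path edges $v_{j-1}v_j$ for $1\le j\le m$. (Equivalently, two fans with a common apex $w_0$, one over the path $w_1u_0u_1\cdots u_n$ and one over the path $v_0v_1\cdots v_m$.) -}

module Defs where

open import Data.Nat using (ℕ; suc; _<_; ∣_-_∣)
open import Data.Fin using (Fin; zero; suc; inject₁)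
open import Data.Product using (Σ; ∃; _×_)
open import Data.Sum using (_⊎_)
open import Relation.Binary.PropositionalEquality using (_≡_; _≢_)
open import Function.Definitions using (Injective)
open import Function.Bundles using (_⇔_)

-- G is a difference graph iff there is an injective f : V → ℕ with positive
-- values (a bijection onto its image S ⊆ ℤ⁺) such that for distinct x, y:
-- x ~ y  ⇔  |f x - f y| ∈ S (i.e. is a value of f).
IsDifferenceGraph : (V : Set) → (V → V → Set) → Set
IsDifferenceGraph V Adj =
  Σ (V → ℕ) λ f →
    (∀ x → 0 < f x) ×
    Injective _≡_ _≡_ f ×
    (∀ x y → x ≢ y → (Adj x y ⇔ ∃ λ z → f z ≡ ∣ f x - f y ∣))

data BVert (n m : ℕ) : Set where
  w0 w1 : BVert n m
  u : Fin (suc n) → BVert n m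
  v : Fin (suc m) → BVert n m

data BEdge (n m : ℕ) : BVert n m → BVert n m → Set where
  w0w1 : BEdge n m w0 w1
  w0u  : (i : Fin (suc n)) → BEdge n m w0 (u i)
  w0v  : (j : Fin (suc m)) → BEdge n m w0 (v j)
  w1u0 : BEdge n m w1 (u zero)
  uu   : (i : Fin n) → BEdge n m (u (inject₁ i)) (u (suc i))
  vv   : (j : Fin m) → BEdge n m (v (inject₁ j)) (v (suc j))

Butterfly : (n m : ℕ) → BVert n m → BVert n m → Set
Butterfly n m x y = BEdge n m x y ⊎ BEdge n m y x

{-# OPTIONS --safe #-}
module Submission where

open import Defs
open import Data.Nat
  using (ℕ; _≤_; _<_; zero; suc; _+_; _*_; ∣_-_∣; z<s; s<s; NonZero)
open import Data.Nat.Properties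
  using (suc-injective; +-comm; +-cancelˡ-≡; *-cancelʳ-≡; ≤-total; even≢odd; m∸n+n≡m;
         m≤n⇒∣n-m∣≡n∸m; m≤n⇒∣m-n∣≡n∸m; ∣m-m+n∣≡n; ∣-∣-comm)
open import Data.Nat.DivMod using (_%_; [m+kn]%n≡m%n; m<n⇒m%n≡m)
open import Data.Nat.Tactic.RingSolver using (solve-∀)
open import Data.Fin using (Fin; zero; suc; toℕ; inject₁)
open import Data.Fin.Properties using (toℕ-injective; toℕ-inject₁)
open import Data.Product using (∃; _×_; _,_; map₂; uncurry)
open import Data.Sum using (_⊎_; inj₁; inj₂; swap)
open import Data.Empty using (⊥-elim)
open import Relation.Binary.PropositionalEquality
  using (_≡_; _≢_; refl; sym; trans; cong; cong₂; subst; module ≡-Reasoning)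
open import Function using (_∘_)
open import Function.Bundles using (mk⇔)

open ≡-Reasoning

-- Label w₀ by 4, the path w₁u₀⋯uₙ by 1, 5, …, 4n+5 and the path v₀⋯vₘ by
-- 3, 7, …, 4m+3.  Every edge then has a label as difference: 4 − ℓ(x) for an
-- edge at the apex, 4 for a path edge.  Conversely, let ℓ(x) − ℓ(y) = ℓ(z).
-- If z = w₀ the difference is 4, and since a label is determined by its
-- residue and quotient mod 4, y and x are neighbours on one of the paths.
-- Otherwise ℓ(z) is odd; as every label but 4 is odd, x or y is the apex w₀,
-- which is adjacent to everything.

residue-quotient-unique : ∀ {r s d} a b .{{_ : NonZero d}} → r < d → s < d →
                          r + a * d ≡ s + b * d → r ≡ s × a ≡ b
residue-quotient-unique {r} {s} {d} a b r<d s<d e = r≡s , a≡b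
  where
  r≡s : r ≡ s
  r≡s = begin
    r               ≡⟨ m<n⇒m%n≡m r<d ⟨
    r % d           ≡⟨ [m+kn]%n≡m%n r a d ⟨
    (r + a * d) % d ≡⟨ cong (_% d) e ⟩
    (s + b * d) % d ≡⟨ [m+kn]%n≡m%n s b d ⟩
    s % d           ≡⟨ m<n⇒m%n≡m s<d ⟩
    s               ∎
  a≡b : a ≡ b
  a≡b = *-cancelʳ-≡ a b d (+-cancelˡ-≡ r _ _ (trans e (cong (_+ b * d) (sym r≡s))))

1+2b+q*4≡1+2[b+q*2] : ∀ b q → suc (2 * b) + q * 4 ≡ suc (2 * (b + q * 2))
1+2b+q*4≡1+2[b+q*2] = solve-∀

4+[r+q*4]≡r+[1+q]*4 : ∀ r q → 4 + (r + q * 4) ≡ r + suc q * 4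
4+[r+q*4]≡r+[1+q]*4 = solve-∀

odd+odd≡even : ∀ a b → suc (2 * a) + suc (2 * b) ≡ 2 * suc (a + b)
odd+odd≡even = solve-∀

n≡m+o⇒∣m-n∣≡o : ∀ {n} m o → n ≡ m + o → ∣ m - n ∣ ≡ o
n≡m+o⇒∣m-n∣≡o m o e = trans (cong (∣ m -_∣) e) (∣m-m+n∣≡n m o)

n≡o+m⇒∣m-n∣≡o : ∀ {n} m o → n ≡ o + m → ∣ m - n ∣ ≡ o
n≡o+m⇒∣m-n∣≡o m o e = n≡m+o⇒∣m-n∣≡o m o (trans e (+-comm o m))

∣m-n∣+n≡m⊎∣m-n∣+m≡n : ∀ m n → ∣ m - n ∣ + n ≡ m ⊎ ∣ m - n ∣ + m ≡ n
∣m-n∣+n≡m⊎∣m-n∣+m≡n m n with ≤-total n m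
... | inj₁ n≤m = inj₁ (trans (cong (_+ n) (m≤n⇒∣n-m∣≡n∸m n≤m)) (m∸n+n≡m n≤m))
... | inj₂ m≤n = inj₂ (trans (cong (_+ m) (m≤n⇒∣m-n∣≡n∸m m≤n)) (m∸n+n≡m m≤n))

module _ {n m : ℕ} where

  residue : BVert n m → ℕ
  residue w0    = 0
  residue w1    = 1
  residue (u _) = 1
  residue (v _) = 3

  level : BVert n m → ℕ
  level w0    = 1
  level w1    = 0
  level (u i) = suc (toℕ i)
  level (v j) = toℕ j

  label : BVert n m → ℕ
  label x = residue x + level x * 4

  residue<4 : ∀ x → residue x < 4
  residue<4 w0    = z<s
  residue<4 w1    = s<s z<s
  residue<4 (u _) = s<s z<s
  residue<4 (v _) = s<s (s<s (s<s z<s))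

  label-positive : ∀ x → 0 < label x
  label-positive w0    = z<s
  label-positive w1    = z<s
  label-positive (u _) = z<s
  label-positive (v _) = z<s

  label-u-suc : (i : Fin n) → label (u (suc i)) ≡ 4 + label (u (inject₁ i))
  label-u-suc i = cong (λ t → 9 + t * 4) (sym (toℕ-inject₁ i))

  label-v-suc : (j : Fin m) → label (v (suc j)) ≡ 4 + label (v (inject₁ j))
  label-v-suc j = cong (λ t → 7 + t * 4) (sym (toℕ-inject₁ j))

  apex-or-odd : ∀ x → x ≡ w0 ⊎ ∃ λ h → label x ≡ suc (2 * h)
  apex-or-odd w0    = inj₁ refl
  apex-or-odd w1    = inj₂ (0 , refl)
  apex-or-odd (u i) = inj₂ (level (u i) * 2 , 1+2b+q*4≡1+2[b+q*2] 0 (level (u i)))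
  apex-or-odd (v j) = inj₂ (1 + level (v j) * 2 , 1+2b+q*4≡1+2[b+q*2] 1 (level (v j)))

  residue-level-injective : ∀ x y → residue x ≡ residue y → level x ≡ level y → x ≡ y
  residue-level-injective w0    w0    _ _ = refl
  residue-level-injective w1    w1    _ _ = refl
  residue-level-injective (u i) (u k) _ e = cong u (toℕ-injective (suc-injective e))
  residue-level-injective (v j) (v k) _ e = cong v (toℕ-injective e)
  residue-level-injective w1    (u _) _ ()
  residue-level-injective (u _) w1    _ ()
  residue-level-injective w0    w1    ()
  residue-level-injective w0    (u _) ()
  residue-level-injective w0    (v _) ()
  residue-level-injective w1    w0    ()
  residue-level-injective w1    (v _) ()
  residue-level-injective (u _) w0    ()
  residue-level-injective (u _) (v _) ()
  residue-level-injective (v _) w0    ()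
  residue-level-injective (v _) w1    ()
  residue-level-injective (v _) (u _) ()

  label-injective : ∀ x y → label x ≡ label y → x ≡ y
  label-injective x y =
    uncurry (residue-level-injective x y)
    ∘ residue-quotient-unique (level x) (level y) (residue<4 x) (residue<4 y)

  successor-edge : ∀ y x → residue y ≡ residue x → suc (level y) ≡ level x →
                   BEdge n m y x
  successor-edge w1    (u zero)    _ _ = w1u0
  successor-edge (u i) (u (suc k)) _ e =
    subst (λ j → BEdge n m (u j) (u (suc k)))
          (toℕ-injective (trans (toℕ-inject₁ k) (suc-injective (suc-injective (sym e)))))
          (uu k)
  successor-edge (v j) (v (suc k)) _ e =
    subst (λ i → BEdge n m (v i) (v (suc k)))
          (toℕ-injective (trans (toℕ-inject₁ k) (suc-injective (sym e))))
          (vv k)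
  successor-edge w0    w0          _ ()
  successor-edge w1    w1          _ ()
  successor-edge w1    (u (suc _)) _ ()
  successor-edge (u _) w1          _ ()
  successor-edge (u _) (u zero)    _ ()
  successor-edge (v _) (v zero)    _ ()
  successor-edge w0    w1          ()
  successor-edge w0    (u _)       ()
  successor-edge w0    (v _)       ()
  successor-edge w1    w0          ()
  successor-edge w1    (v _)       ()
  successor-edge (u _) w0          ()
  successor-edge (u _) (v _)       ()
  successor-edge (v _) w0          ()
  successor-edge (v _) w1          ()
  successor-edge (v _) (u _)       ()

  step-edge : ∀ x y → 4 + label y ≡ label x → BEdge n m y x
  step-edge x y =
    uncurry (successor-edge y x)
    ∘ residue-quotient-unique (suc (level y)) (level x) (residue<4 y) (residue<4 x)
    ∘ trans (sym (4+[r+q*4]≡r+[1+q]*4 (residue y) (level y)))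

  apex-edge : ∀ x → x ≢ w0 → BEdge n m w0 x
  apex-edge w0    x≢w0 = ⊥-elim (x≢w0 refl)
  apex-edge w1    _    = w0w1
  apex-edge (u i) _    = w0u i
  apex-edge (v j) _    = w0v j

  LabelDifference : BVert n m → BVert n m → Set
  LabelDifference x y = ∃ λ z → label z ≡ ∣ label x - label y ∣

  edge-difference : ∀ {x y} → BEdge n m x y → LabelDifference x y
  edge-difference w0w1          = v zero , refl
  edge-difference (w0u zero)    = w1 , refl
  edge-difference (w0u (suc i)) =
    u (inject₁ i) , sym (n≡m+o⇒∣m-n∣≡o 4 (label (u (inject₁ i))) (label-u-suc i))
  edge-difference (w0v zero)    = w1 , refl
  edge-difference (w0v (suc j)) =
    v (inject₁ j) , sym (n≡m+o⇒∣m-n∣≡o 4 (label (v (inject₁ j))) (label-v-suc j))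
  edge-difference w1u0          = w0 , refl
  edge-difference (uu i)        =
    w0 , sym (n≡o+m⇒∣m-n∣≡o (label (u (inject₁ i))) 4 (label-u-suc i))
  edge-difference (vv j)        =
    w0 , sym (n≡o+m⇒∣m-n∣≡o (label (v (inject₁ j))) 4 (label-v-suc j))

  adjacent-difference : ∀ x y → Butterfly n m x y → LabelDifference x y
  adjacent-difference _ _ (inj₁ xy) = edge-difference xy
  adjacent-difference x y (inj₂ yx) =
    map₂ (λ e → trans e (∣-∣-comm (label y) (label x))) (edge-difference yx)

  sum-adjacent : ∀ x y z → x ≢ y → label z + label y ≡ label x → Butterfly n m x y
  sum-adjacent x y z x≢y e with apex-or-odd z
  ... | inj₁ refl = inj₂ (step-edge x y e)
  ... | inj₂ (a , z-odd) with apex-or-odd y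
  ...   | inj₁ refl = inj₂ (apex-edge x x≢y)
  ...   | inj₂ (b , y-odd) with apex-or-odd x
  ...     | inj₁ refl = inj₁ (apex-edge y (x≢y ∘ sym))
  ...     | inj₂ (c , x-odd) = ⊥-elim (even≢odd (suc (a + b)) c even≡odd)
    where
    even≡odd : 2 * suc (a + b) ≡ suc (2 * c)
    even≡odd = begin
      2 * suc (a + b)             ≡⟨ odd+odd≡even a b ⟨
      suc (2 * a) + suc (2 * b)   ≡⟨ cong₂ _+_ z-odd y-odd ⟨
      label z + label y           ≡⟨ e ⟩
      label x                     ≡⟨ x-odd ⟩
      suc (2 * c)                 ∎

  difference-adjacent : ∀ x y → x ≢ y → LabelDifference x y → Butterfly n m x y
  difference-adjacent x y x≢y (z , d) with ∣m-n∣+n≡m⊎∣m-n∣+m≡n (label x) (label y)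
  ... | inj₁ e = sum-adjacent x y z x≢y (trans (cong (_+ label y) d) e)
  ... | inj₂ e = swap (sum-adjacent y x z (x≢y ∘ sym) (trans (cong (_+ label x) d) e))

theorem3p3 : (n m : ℕ) → 1 ≤ n → 1 ≤ m → IsDifferenceGraph (BVert n m) (Butterfly n m)
theorem3p3 n m _ _ =
  label , label-positive , (λ {x} {y} → label-injective x y) ,
  λ x y x≢y → mk⇔ (adjacent-difference x y) (difference-adjacent x y x≢y)
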